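{- For every integer $n\geq 4$, the triangular graph $T_n$ is not eigensharp, that is, $N(T_n)\geq n$.
   Context: The triangular graph $T_n$ is the line graph of the complete graph $K_n$. For a connected graph $G$, a $t$-address is a $t$-tuple with entries in $\{0,a,b\}$ ($a,b$ distinct non-zero symbols), and an addressing of length $t$ of $G$ is an assignment of $t$-addresses to the vertices such that for any two vertices $u,v$ the distance $d_G(u,v)$ equals the number of positions in which one address equals $a$ and the other equals $b$. $N(G)$ is the minimum length of an addressing of $G$. The distance matrix $D(G)$ has $(u,v)$-entry $d_G(u,v)$; $n_+(M)$, $n_-(M)$ denote the numbers of positive and negative eigenvalues (with multiplicity) of a real symmetric matrix $M$. It is known that $N(G)\ge \max(n_+(D(G)),n_-(D(G)))$, and $G$ is eigensharp if equality holds. For $n\ge 4$, $\max(n_+(D(T_n)),n_-(D(T_n)))=n-1$. -}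

module Defs where

open import Data.Nat using (ℕ; zero; suc; _≤_)
open import Data.Fin using (Fin; _<_)
open import Data.Vec using (Vec; zipWith)
open import Data.Vec using () renaming (sum to vsum)
open import Data.Product using (Σ; _×_; _,_)
open import Data.Sum using (_⊎_)
open import Relation.Nullary using (¬_)
open import Relation.Binary.PropositionalEquality using (_≡_)

data Walk {V : Set} (E : V → V → Set) : V → V → ℕ → Set where
  nil  : ∀ {u} → Walk E u u 0
  cons : ∀ {u w v k} → E u w → Walk E w v k → Walk E u v (suc k)

IsDist : {V : Set} → (V → V → Set) → V → V → ℕ → Set
IsDist E u v k = Walk E u v k × (∀ m → Walk E u v m → k ≤ m)

data Sym : Set where
  s0 sa sb : Sym

mismatch : Sym → Sym → ℕ
mismatch sa sb = 1
mismatch sb sa = 1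
mismatch _  _  = 0

addrDist : ∀ {t} → Vec Sym t → Vec Sym t → ℕ
addrDist x y = vsum (zipWith mismatch x y)

IsAddressing : {V : Set} (E : V → V → Set) (t : ℕ) → (V → Vec Sym t) → Set
IsAddressing E t f = ∀ u v → IsDist E u v (addrDist (f u) (f v))

-- Triangular graph T_n = line graph of K_n:
-- vertices are 2-subsets {i,j} of Fin n, represented as pairs with i < j;
-- two distinct such edges are adjacent iff they share an endpoint.
TVertex : ℕ → Set
TVertex n = Σ (Fin n × Fin n) (λ { (i , j) → i < j })

TAdj : ∀ {n} → TVertex n → TVertex n → Set
TAdj ((i , j) , _) ((k , l) , _) =
  ¬ (i ≡ k × j ≡ l) × (i ≡ k ⊎ i ≡ l ⊎ j ≡ k ⊎ j ≡ l)

{-# OPTIONS --safe #-}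
module Submission where

-- Let A_u, B_u ∈ {0,1}ᵗ mark the positions of the letters a and b in the address of u, so
-- that d(u,v) = A_u·B_v + B_u·A_v, while in T_n also d(u,v) = 2 − |u ∩ v|. For integer
-- weights z on vertices with Σ z = 0 and Σ z_u B_u = 0 the form zᵀDz therefore vanishes and
-- equals −|Σ z_u 1_u|², so Σ z_u 1_u = 0, where 1_u is the incidence vector of the edge u of K_n.
-- If t < n, these t + 1 linear conditions together with z_e = 0 for a chosen vertex e have a
-- nonzero solution on the n + 2 vertices 12, 13, 23, 01, …, 0(n−1), and Σ z_u 1_u = 0 makes it a
-- multiple of the alternating sum around a 4-cycle of K₄. Hence in every coordinate b, and
-- symmetrically a, is balanced along the 4-cycles 1230 and 1320. This forces an even number of
-- mismatches inside the triangle 01, 02, 12 in every coordinate, but its three distances sum to 3.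

open import Data.Nat using (ℕ; _≤_)
open import Data.Vec as Vec using (Vec; lookup)
open import Defs

open import Data.Nat as ℕ using (zero; suc; s≤s)
import Data.Nat.Properties as ℕ
open import Data.Integer as ℤ using (ℤ; +_; -[1+_]; 0ℤ; 1ℤ; _+_; _*_; -_; _-_)
import Data.Integer.Properties as ℤ
open import Data.Integer.Tactic.RingSolver using (solve-∀; solve)
open import Data.List using ([]; _∷_)
open import Data.Fin as Fin using (Fin; zero; suc; punchIn; punchOut; _↑ʳ_)
open import Data.Fin.Patterns using (0F; 1F; 2F; 3F; 4F; 5F)
open import Data.Fin.Properties as Fin using (all?; ¬∀⟶∃¬; punchIn-punchOut)
open import Data.Vec.Functional using (Vector; head; tail)
open import Data.Product using (_×_; _,_; ∃-syntax; proj₁; proj₂)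
open import Data.Sum using (inj₁; inj₂; [_,_]′)
open import Function using (_∘_; id)
open import Relation.Nullary using (¬_; Dec; yes; no; contradiction)
open import Relation.Binary.Definitions using (Tri; tri<; tri≈; tri>)
open import Relation.Binary.PropositionalEquality
open import Relation.Nullary.Decidable using (map′; _×-dec_; _→-dec_; from-yes; from-no)
open import Data.Integer.Divisibility.Signed using (_∣_; _∣?_; divides; ∣m∣n⇒∣m+n)
open import Data.Empty using (⊥)
open ≡-Reasoning

open import Algebra.Properties.Semiring.Sum ℤ.+-*-semiring
  using (sum; sum-syntax; ∑-distrib-+; ∑-comm; *-distribˡ-sum; *-distribʳ-sum; sum-cong-≗; sum-replicate-zero)

∑-zero : ∀ {k} (f : Vector ℤ k) → (∀ i → f i ≡ 0ℤ) → sum f ≡ 0ℤ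
∑-zero {k} f f≡0 = trans (sum-cong-≗ f≡0) (sum-replicate-zero k)

∑-linear : ∀ {k} a b (f g : Vector ℤ k) → ∑[ i < k ] (a * f i + b * g i) ≡ a * sum f + b * sum g
∑-linear a b f g = trans (∑-distrib-+ (λ i → a * f i) (λ i → b * g i))
                         (cong₂ _+_ (sym (*-distribˡ-sum a f)) (sym (*-distribˡ-sum b g)))

*-cancel-≡0 : ∀ {a x} → a ≢ 0ℤ → a * x ≡ 0ℤ → x ≡ 0ℤ
*-cancel-≡0 {a} a≢0 ax≡0 = [ (λ a≡0 → contradiction a≡0 a≢0) , id ]′ (ℤ.i*j≡0⇒i≡0∨j≡0 a ax≡0)

-- Homogeneous linear systems over ℤ

infix 7 _·_

_·_ : ∀ {k} → Vector ℤ k → Vector ℤ k → ℤ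
x · y = ∑[ i < _ ] (x i * y i)

IsZero : ∀ {k} → Vector ℤ k → Set
IsZero x = ∀ i → x i ≡ 0ℤ

module _ {k : ℕ} where

  unit₀ : Vector ℤ (suc k)
  unit₀ zero    = 1ℤ
  unit₀ (suc _) = 0ℤ

  unit₀·≡head : ∀ r → unit₀ · r ≡ head r
  unit₀·≡head r = begin
    1ℤ * head r + ∑[ i < k ] (0ℤ * r (suc i))
      ≡⟨ cong₂ _+_ (ℤ.*-identityˡ (head r)) (∑-zero _ (λ i → ℤ.*-zeroˡ (r (suc i)))) ⟩
    head r + 0ℤ                              ≡⟨ ℤ.+-identityʳ (head r) ⟩
    head r                                   ∎

  -- Fraction-free elimination of the first unknown, using the pivot row e.
  eliminate : Vector ℤ (suc k) → Vector ℤ (suc k) → Vector ℤ k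
  eliminate e r i = head e * r (suc i) - head r * e (suc i)

  backSubstitute : Vector ℤ (suc k) → Vector ℤ k → Vector ℤ (suc k)
  backSubstitute e y zero    = - (y · tail e)
  backSubstitute e y (suc i) = head e * y i

  backSubstitute·≡· : ∀ e y r → backSubstitute e y · r ≡ y · eliminate e r
  backSubstitute·≡· e y r = begin
    - (y · tail e) * head r + ∑[ i < k ] (head e * y i * r (suc i))
      ≡⟨ cong (_+_ (- (y · tail e) * head r))
           (trans (sum-cong-≗ (λ i → ℤ.*-assoc (head e) (y i) (r (suc i))))
                  (sym (*-distribˡ-sum (head e) (λ i → y i * r (suc i))))) ⟩
    - (y · tail e) * head r + head e * (y · tail r)
      ≡⟨ rearrange (y · tail e) (head r) (head e) (y · tail r) ⟩
    head e * (y · tail r) + (- head r) * (y · tail e)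
      ≡⟨ ∑-linear (head e) (- head r) (λ i → y i * r (suc i)) (λ i → y i * e (suc i)) ⟨
    ∑[ i < k ] (head e * (y i * r (suc i)) + (- head r) * (y i * e (suc i)))
      ≡⟨ sum-cong-≗ (λ i → expand (head e) (head r) (y i) (r (suc i)) (e (suc i))) ⟩
    y · eliminate e r
      ∎
    where
    rearrange : ∀ p r₀ e₀ q → - p * r₀ + e₀ * q ≡ e₀ * q + (- r₀) * p
    rearrange = solve-∀
    expand : ∀ e₀ r₀ yᵢ rᵢ eᵢ → e₀ * (yᵢ * rᵢ) + (- r₀) * (yᵢ * eᵢ) ≡ yᵢ * (e₀ * rᵢ - r₀ * eᵢ)
    expand = solve-∀

unit₀≢0 : ∀ {k} → ¬ IsZero (unit₀ {k})
unit₀≢0 unit₀≡0 with unit₀≡0 zero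
... | ()

mutual
  homogeneous-solution : ∀ {m k} → m ℕ.< k → (rows : Fin m → Vector ℤ k) →
                         ∃[ z ] ¬ IsZero z × (∀ j → z · rows j ≡ 0ℤ)
  homogeneous-solution {m} {suc k} m<k rows with all? (λ j → head (rows j) ℤ.≟ 0ℤ)
  ... | yes column₀≡0 = unit₀ , unit₀≢0 , λ j → trans (unit₀·≡head (rows j)) (column₀≡0 j)
  ... | no column₀≢0 = homogeneous-solution-pivot m<k rows (¬∀⟶∃¬ m _ (λ j → head (rows j) ℤ.≟ 0ℤ) column₀≢0)

  homogeneous-solution-pivot : ∀ {m k} → m ℕ.< suc k → (rows : Fin m → Vector ℤ (suc k)) →
                               ∃[ p ] head (rows p) ≢ 0ℤ → ∃[ z ] ¬ IsZero z × (∀ j → z · rows j ≡ 0ℤ)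
  homogeneous-solution-pivot {suc m} {k} (s≤s m<k) rows (p , e₀≢0) = backSubstitute e y , z≢0 , z⊥rows
    where
    e = rows p
    solution = homogeneous-solution m<k (λ j → eliminate e (rows (punchIn p j)))
    y = proj₁ solution
    y⊥eliminated : ∀ j → y · eliminate e (rows j) ≡ 0ℤ
    y⊥eliminated j with p Fin.≟ j
    ... | yes refl = ∑-zero _ (λ i → trans (cong (y i *_) (ℤ.+-inverseʳ (head e * e (suc i)))) (ℤ.*-zeroʳ (y i)))
    ... | no p≢j = subst (λ j → y · eliminate e (rows j) ≡ 0ℤ) (punchIn-punchOut p≢j)
                         (proj₂ (proj₂ solution) (punchOut p≢j))
    z⊥rows : ∀ j → backSubstitute e y · rows j ≡ 0ℤ
    z⊥rows j = trans (backSubstitute·≡· e y (rows j)) (y⊥eliminated j)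
    z≢0 : ¬ IsZero (backSubstitute e y)
    z≢0 z≡0 = proj₁ (proj₂ solution) λ i → *-cancel-≡0 e₀≢0 (z≡0 (suc i))

-- Incidence vectors and distances in T_n

δ : ∀ {k} → Fin k → Fin k → ℤ
δ zero    zero    = 1ℤ
δ zero    (suc _) = 0ℤ
δ (suc _) zero    = 0ℤ
δ (suc i) (suc j) = δ i j

δ-sym : ∀ {k} (i j : Fin k) → δ i j ≡ δ j i
δ-sym zero    zero    = refl
δ-sym zero    (suc _) = refl
δ-sym (suc _) zero    = refl
δ-sym (suc i) (suc j) = δ-sym i j

δ-≡ : ∀ {k} {i j : Fin k} → i ≡ j → δ i j ≡ 1ℤ
δ-≡ {i = zero}  refl = refl
δ-≡ {i = suc i} refl = δ-≡ {i = i} refl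

δ-≢ : ∀ {k} {i j : Fin k} → i ≢ j → δ i j ≡ 0ℤ
δ-≢ {i = zero}  {zero}  i≢j = contradiction refl i≢j
δ-≢ {i = zero}  {suc _} _   = refl
δ-≢ {i = suc _} {zero}  _   = refl
δ-≢ {i = suc i} {suc j} i≢j = δ-≢ (i≢j ∘ cong suc)

·-δ : ∀ {k} (x : Vector ℤ k) i → x · δ i ≡ x i
·-δ {suc k} x zero = begin
  x zero * 1ℤ + ∑[ i < k ] (x (suc i) * 0ℤ) ≡⟨ cong₂ _+_ (ℤ.*-identityʳ (x zero)) (∑-zero _ (ℤ.*-zeroʳ ∘ x ∘ suc)) ⟩
  x zero + 0ℤ                               ≡⟨ ℤ.+-identityʳ (x zero) ⟩
  x zero                                    ∎
·-δ {suc k} x (suc i) = begin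
  x zero * 0ℤ + tail x · δ i ≡⟨ cong₂ _+_ (ℤ.*-zeroʳ (x zero)) (·-δ (tail x) i) ⟩
  0ℤ + x (suc i)             ≡⟨ ℤ.+-identityˡ (x (suc i)) ⟩
  x (suc i)                  ∎

incidence : ∀ {n} → TVertex n → Vector ℤ n
incidence ((p , q) , _) i = δ p i + δ q i

·-incidence : ∀ {n} (x : Vector ℤ n) (u : TVertex n) → x · incidence u ≡ x (proj₁ (proj₁ u)) + x (proj₂ (proj₁ u))
·-incidence x ((p , q) , _) = begin
  ∑[ i < _ ] (x i * (δ p i + δ q i))        ≡⟨ sum-cong-≗ (λ i → ℤ.*-distribˡ-+ (x i) (δ p i) (δ q i)) ⟩
  ∑[ i < _ ] (x i * δ p i + x i * δ q i)    ≡⟨ ∑-distrib-+ (λ i → x i * δ p i) (λ i → x i * δ q i) ⟩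
  x · δ p + x · δ q                         ≡⟨ cong₂ _+_ (·-δ x p) (·-δ x q) ⟩
  x p + x q                                 ∎

module _ {V : Set} {E : V → V → Set} where

  dist-self : ∀ {u d} → IsDist E u u d → d ≡ 0
  dist-self (nil , _) = refl
  dist-self (cons _ _ , minimal) with minimal 0 nil
  ... | ()

  dist-adjacent : ∀ {u v d} → E u v → u ≢ v → IsDist E u v d → d ≡ 1
  dist-adjacent _ u≢v (nil , _) = contradiction refl u≢v
  dist-adjacent _ _ (cons _ nil , _) = refl
  dist-adjacent e _ (cons _ (cons _ _) , minimal) with minimal 1 (cons e nil)
  ... | s≤s ()

  dist-two : ∀ {u v d} → Walk E u v 2 → u ≢ v → ¬ E u v → IsDist E u v d → d ≡ 2
  dist-two _ u≢v _ (nil , _) = contradiction refl u≢v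
  dist-two _ _ ¬e (cons e nil , _) = contradiction e ¬e
  dist-two _ _ _ (cons _ (cons _ nil) , _) = refl
  dist-two w _ _ (cons _ (cons _ (cons _ _)) , minimal) with minimal 2 w
  ... | s≤s (s≤s ())

module _ {n : ℕ} where

  vertex-≡ : ∀ {p q k l : Fin n} (p<q : p Fin.< q) (k<l : k Fin.< l) → p ≡ k → q ≡ l →
             _≡_ {A = TVertex n} ((p , q) , p<q) ((k , l) , k<l)
  vertex-≡ p<q k<l refl refl = cong (_ ,_) (ℕ.<-irrelevant p<q k<l)

  TAdj⇒≢ : ∀ {u v : TVertex n} → TAdj u v → u ≢ v
  TAdj⇒≢ (not-same , _) refl = not-same (refl , refl)

  adjacent⇒dist≡1 : ∀ {u v : TVertex n} {d} → TAdj u v → IsDist TAdj u v d → d ≡ 1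
  adjacent⇒dist≡1 adj = dist-adjacent adj (TAdj⇒≢ adj)

  distance+overlap≡2 : ∀ {u v : TVertex n} {d} → IsDist TAdj u v d → + d + incidence u · incidence v ≡ + 2
  distance+overlap≡2 {u@((p , q) , p<q)} {v@((k , l) , k<l)} {d} dist =
    trans (cong (_+_ (+ d)) (·-incidence (incidence u) v)) (count (p Fin.≟ k) (q Fin.≟ l) (p Fin.≟ l) (q Fin.≟ k))
    where
    p≢q = Fin.<⇒≢ p<q
    k≢l = Fin.<⇒≢ k<l
    evaluate : ∀ {d′ a b c e} → d ≡ d′ → δ p k ≡ a → δ q k ≡ b → δ p l ≡ c → δ q l ≡ e →
               + d + ((δ p k + δ q k) + (δ p l + δ q l)) ≡ + d′ + ((a + b) + (c + e))
    evaluate d≡ pk qk pl ql = cong₂ _+_ (cong +_ d≡) (cong₂ _+_ (cong₂ _+_ pk qk) (cong₂ _+_ pl ql))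
    count : Dec (p ≡ k) → Dec (q ≡ l) → Dec (p ≡ l) → Dec (q ≡ k) →
            + d + ((δ p k + δ q k) + (δ p l + δ q l)) ≡ + 2
    count (yes p≡k) (yes q≡l) _ _ =
      evaluate (dist-self (subst (λ w → IsDist TAdj u w d) (sym (vertex-≡ p<q k<l p≡k q≡l)) dist))
               (δ-≡ p≡k) (δ-≢ λ q≡k → k≢l (trans (sym q≡k) q≡l))
               (δ-≢ λ p≡l → k≢l (trans (sym p≡k) p≡l)) (δ-≡ q≡l)
    count (yes p≡k) (no q≢l) _ _ =
      evaluate (adjacent⇒dist≡1 ((λ { (_ , q≡l) → q≢l q≡l }) , inj₁ p≡k) dist)
               (δ-≡ p≡k) (δ-≢ λ q≡k → p≢q (trans p≡k (sym q≡k)))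
               (δ-≢ λ p≡l → k≢l (trans (sym p≡k) p≡l)) (δ-≢ q≢l)
    count (no p≢k) (yes q≡l) _ _ =
      evaluate (adjacent⇒dist≡1 ((λ { (p≡k , _) → p≢k p≡k }) , inj₂ (inj₂ (inj₂ q≡l))) dist)
               (δ-≢ p≢k) (δ-≢ λ q≡k → k≢l (trans (sym q≡k) q≡l))
               (δ-≢ λ p≡l → p≢q (trans p≡l (sym q≡l))) (δ-≡ q≡l)
    count (no p≢k) (no q≢l) (yes p≡l) _ =
      evaluate (adjacent⇒dist≡1 ((λ { (p≡k , _) → p≢k p≡k }) , inj₂ (inj₁ p≡l)) dist)
               (δ-≢ p≢k) (δ-≢ λ q≡k → Fin.<-asym p<q (subst₂ Fin._<_ (sym q≡k) (sym p≡l) k<l)) (δ-≡ p≡l) (δ-≢ q≢l)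
    count (no p≢k) (no q≢l) (no p≢l) (yes q≡k) =
      evaluate (adjacent⇒dist≡1 ((λ { (p≡k , _) → p≢k p≡k }) , inj₂ (inj₂ (inj₁ q≡k))) dist)
               (δ-≢ p≢k) (δ-≡ q≡k) (δ-≢ p≢l) (δ-≢ q≢l)
    count (no p≢k) (no q≢l) (no p≢l) (no q≢k) =
      evaluate (dist-two (through (Fin.<-cmp p k)) (p≢k ∘ cong (proj₁ ∘ proj₁)) disjoint dist)
               (δ-≢ p≢k) (δ-≢ q≢k) (δ-≢ p≢l) (δ-≢ q≢l)
      where
      disjoint : ¬ TAdj u v
      disjoint (_ , inj₁ p≡k)               = p≢k p≡k
      disjoint (_ , inj₂ (inj₁ p≡l))        = p≢l p≡l
      disjoint (_ , inj₂ (inj₂ (inj₁ q≡k))) = q≢k q≡k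
      disjoint (_ , inj₂ (inj₂ (inj₂ q≡l))) = q≢l q≡l
      through : Tri (p Fin.< k) (p ≡ k) (k Fin.< p) → Walk TAdj u v 2
      through (tri< p<k _ _) = cons {w = (p , k) , p<k} ((λ { (_ , q≡k) → q≢k q≡k }) , inj₁ refl)
                                    (cons ((λ { (p≡k , _) → p≢k p≡k }) , inj₂ (inj₂ (inj₁ refl))) nil)
      through (tri≈ _ p≡k _) = contradiction p≡k p≢k
      through (tri> _ _ k<p) = cons {w = (k , p) , k<p} ((λ { (p≡k , _) → p≢k p≡k }) , inj₂ (inj₁ refl))
                                    (cons ((λ { (_ , p≡l) → p≢l p≡l }) , inj₁ refl) nil)

-- Quadratic forms

0≤i*i : ∀ i → 0ℤ ℤ.≤ i * i
0≤i*i (+ n)    = subst (0ℤ ℤ.≤_) (sym (ℤ.+◃n≡+n (n ℕ.* n))) (ℤ.+≤+ ℕ.z≤n)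
0≤i*i -[1+ n ] = ℤ.+≤+ ℕ.z≤n

0≤x·x : ∀ {k} (x : Vector ℤ k) → 0ℤ ℤ.≤ x · x
0≤x·x {zero}  x = ℤ.≤-refl
0≤x·x {suc k} x = ℤ.+-mono-≤ (0≤i*i (x zero)) (0≤x·x (tail x))

i+j≡0⇒i≡0×j≡0 : ∀ {i j} → 0ℤ ℤ.≤ i → 0ℤ ℤ.≤ j → i + j ≡ 0ℤ → i ≡ 0ℤ × j ≡ 0ℤ
i+j≡0⇒i≡0×j≡0 {+ m} {+ n} _ _ m+n≡0 =
  cong +_ (ℕ.m+n≡0⇒m≡0 m (ℤ.+-injective m+n≡0)) , cong +_ (ℕ.m+n≡0⇒n≡0 m (ℤ.+-injective m+n≡0))

x·x≡0⇒x≡0 : ∀ {k} (x : Vector ℤ k) → x · x ≡ 0ℤ → IsZero x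
x·x≡0⇒x≡0 {suc k} x x·x≡0 i with i+j≡0⇒i≡0×j≡0 (0≤i*i (x zero)) (0≤x·x (tail x)) x·x≡0
x·x≡0⇒x≡0 {suc k} x x·x≡0 zero    | x₀²≡0 , _ = [ id , id ]′ (ℤ.i*j≡0⇒i≡0∨j≡0 (x zero) x₀²≡0)
x·x≡0⇒x≡0 {suc k} x x·x≡0 (suc i) | _ , rest≡0 = x·x≡0⇒x≡0 (tail x) rest≡0 i

∑-product : ∀ {k m} (a : Vector ℤ k) (b : Vector ℤ m) → ∑[ u < k ] ∑[ v < m ] (a u * b v) ≡ sum a * sum b
∑-product a b = trans (sum-cong-≗ λ u → sym (*-distribˡ-sum (a u) b)) (sym (*-distribʳ-sum (sum b) a))

module _ {k : ℕ} (z : Vector ℤ k) where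

  form : (Fin k → Fin k → ℤ) → ℤ
  form M = ∑[ u < k ] ∑[ v < k ] (z u * z v * M u v)

  lincomb : ∀ {m} → (Fin k → Vector ℤ m) → Vector ℤ m
  lincomb P c = z · λ u → P u c

  form-cong : ∀ {M N} → (∀ u v → M u v ≡ N u v) → form M ≡ form N
  form-cong M≡N = sum-cong-≗ λ u → sum-cong-≗ λ v → cong (z u * z v *_) (M≡N u v)

  form-+ : ∀ M N → form (λ u v → M u v + N u v) ≡ form M + form N
  form-+ M N = begin
    ∑[ u < k ] ∑[ v < k ] (z u * z v * (M u v + N u v))
      ≡⟨ sum-cong-≗ (λ u → sum-cong-≗ λ v → ℤ.*-distribˡ-+ (z u * z v) (M u v) (N u v)) ⟩
    ∑[ u < k ] ∑[ v < k ] (z u * z v * M u v + z u * z v * N u v)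
      ≡⟨ sum-cong-≗ (λ u → ∑-distrib-+ (λ v → z u * z v * M u v) (λ v → z u * z v * N u v)) ⟩
    ∑[ u < k ] (∑[ v < k ] (z u * z v * M u v) + ∑[ v < k ] (z u * z v * N u v))
      ≡⟨ ∑-distrib-+ (λ u → ∑[ v < k ] (z u * z v * M u v)) (λ u → ∑[ v < k ] (z u * z v * N u v)) ⟩
    form M + form N
      ∎

  form-outer : ∀ {m} (P Q : Fin k → Vector ℤ m) → form (λ u v → P u · Q v) ≡ lincomb P · lincomb Q
  form-outer {m} P Q = begin
    ∑[ u < k ] ∑[ v < k ] (z u * z v * (P u · Q v))
      ≡⟨ sum-cong-≗ (λ u → sum-cong-≗ λ v → expand u v) ⟩
    ∑[ u < k ] ∑[ v < k ] ∑[ c < m ] (z u * P u c * (z v * Q v c))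
      ≡⟨ sum-cong-≗ (λ u → ∑-comm λ v c → z u * P u c * (z v * Q v c)) ⟩
    ∑[ u < k ] ∑[ c < m ] ∑[ v < k ] (z u * P u c * (z v * Q v c))
      ≡⟨ ∑-comm (λ u c → ∑[ v < k ] (z u * P u c * (z v * Q v c))) ⟩
    ∑[ c < m ] ∑[ u < k ] ∑[ v < k ] (z u * P u c * (z v * Q v c))
      ≡⟨ sum-cong-≗ (λ c → ∑-product (λ u → z u * P u c) (λ v → z v * Q v c)) ⟩
    lincomb P · lincomb Q
      ∎
    where
    expand : ∀ u v → z u * z v * (P u · Q v) ≡ ∑[ c < m ] (z u * P u c * (z v * Q v c))
    expand u v = trans (*-distribˡ-sum (z u * z v) (λ c → P u c * Q v c))
                       (sum-cong-≗ λ c → regroup (z u) (z v) (P u c) (Q v c))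
      where
      regroup : ∀ a b x y → a * b * (x * y) ≡ a * x * (b * y)
      regroup = solve-∀

  form-const≡0 : sum z ≡ 0ℤ → ∀ x → form (λ _ _ → x) ≡ 0ℤ
  form-const≡0 ∑z≡0 x = begin
    ∑[ u < k ] ∑[ v < k ] (z u * z v * x)   ≡⟨ sum-cong-≗ (λ u → sum-cong-≗ λ v → regroup (z u) (z v) x) ⟩
    ∑[ u < k ] ∑[ v < k ] (z u * x * z v)   ≡⟨ ∑-product (λ u → z u * x) z ⟩
    ∑[ u < k ] (z u * x) * sum z            ≡⟨ cong (∑[ u < k ] (z u * x) *_) ∑z≡0 ⟩
    ∑[ u < k ] (z u * x) * 0ℤ               ≡⟨ ℤ.*-zeroʳ (∑[ u < k ] (z u * x)) ⟩
    0ℤ                                      ∎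
    where
    regroup : ∀ a b x → a * b * x ≡ a * x * b
    regroup = solve-∀

-- Addressings

isA isB : Sym → ℤ
isA sa = 1ℤ
isA _  = 0ℤ
isB sb = 1ℤ
isB _  = 0ℤ

mismatch-split : ∀ x y → + mismatch x y ≡ isA x * isB y + isB x * isA y
mismatch-split s0 _  = refl
mismatch-split sa s0 = refl
mismatch-split sa sa = refl
mismatch-split sa sb = refl
mismatch-split sb s0 = refl
mismatch-split sb sa = refl
mismatch-split sb sb = refl

mismatch-split′ : ∀ x y → + mismatch x y ≡ isB x * isA y + isA x * isB y
mismatch-split′ x y = trans (mismatch-split x y) (ℤ.+-comm (isA x * isB y) (isB x * isA y))

+addrDist≡∑ : ∀ {t} (x y : Vec Sym t) → + addrDist x y ≡ ∑[ c < t ] (+ mismatch (lookup x c) (lookup y c))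
+addrDist≡∑ Vec.[]       Vec.[]       = refl
+addrDist≡∑ (a Vec.∷ xs) (b Vec.∷ ys) =
  trans (ℤ.pos-+ (mismatch a b) (addrDist xs ys)) (cong (_+_ (+ mismatch a b)) (+addrDist≡∑ xs ys))

module _ {n t} {f : TVertex n → Vec Sym t} (addressing : IsAddressing (TAdj {n}) t f)
         {k} (g : Fin k → TVertex n) where

  letters : (Sym → ℤ) → Fin k → Vector ℤ t
  letters χ u c = χ (lookup (f (g u)) c)

  module _ {χ χ′ : Sym → ℤ} (split : ∀ x y → + mismatch x y ≡ χ x * χ′ y + χ′ x * χ y) where

    distance-split : ∀ u v → + addrDist (f (g u)) (f (g v)) ≡ letters χ u · letters χ′ v + letters χ′ u · letters χ v
    distance-split u v = begin
      + addrDist (f (g u)) (f (g v))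
        ≡⟨ +addrDist≡∑ (f (g u)) (f (g v)) ⟩
      ∑[ c < t ] (+ mismatch (lookup (f (g u)) c) (lookup (f (g v)) c))
        ≡⟨ sum-cong-≗ (λ c → split (lookup (f (g u)) c) (lookup (f (g v)) c)) ⟩
      ∑[ c < t ] (letters χ u c * letters χ′ v c + letters χ′ u c * letters χ v c)
        ≡⟨ ∑-distrib-+ (λ c → letters χ u c * letters χ′ v c) (λ c → letters χ′ u c * letters χ v c) ⟩
      letters χ u · letters χ′ v + letters χ′ u · letters χ v
        ∎

    incidence-combination≡0 : ∀ z → sum z ≡ 0ℤ → IsZero (lincomb z (letters χ)) → IsZero (lincomb z (incidence ∘ g))
    incidence-combination≡0 z ∑z≡0 χ-comb≡0 = x·x≡0⇒x≡0 S S·S≡0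
      where
      D O : Fin k → Fin k → ℤ
      D u v = + addrDist (f (g u)) (f (g v))
      O u v = incidence (g u) · incidence (g v)
      S = lincomb z (incidence ∘ g)
      X = lincomb z (letters χ)
      X′ = lincomb z (letters χ′)

      distance-form≡0 : form z D ≡ 0ℤ
      distance-form≡0 = begin
        form z D
          ≡⟨ form-cong z distance-split ⟩
        form z (λ u v → letters χ u · letters χ′ v + letters χ′ u · letters χ v)
          ≡⟨ form-+ z (λ u v → letters χ u · letters χ′ v) (λ u v → letters χ′ u · letters χ v) ⟩
        form z (λ u v → letters χ u · letters χ′ v) + form z (λ u v → letters χ′ u · letters χ v)
          ≡⟨ cong₂ _+_ (form-outer z (letters χ) (letters χ′)) (form-outer z (letters χ′) (letters χ)) ⟩
        X · X′ + X′ · X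
          ≡⟨ cong₂ _+_ (∑-zero _ λ c → trans (cong (_* X′ c) (χ-comb≡0 c)) (ℤ.*-zeroˡ (X′ c)))
                       (∑-zero _ λ c → trans (cong (X′ c *_) (χ-comb≡0 c)) (ℤ.*-zeroʳ (X′ c))) ⟩
        0ℤ
          ∎

      S·S≡0 : S · S ≡ 0ℤ
      S·S≡0 = begin
        S · S                           ≡⟨ form-outer z (incidence ∘ g) (incidence ∘ g) ⟨
        form z O                        ≡⟨ ℤ.+-identityˡ (form z O) ⟨
        0ℤ + form z O                   ≡⟨ cong (_+ form z O) distance-form≡0 ⟨
        form z D + form z O             ≡⟨ form-+ z D O ⟨
        form z (λ u v → D u v + O u v)  ≡⟨ form-cong z (λ u v → distance+overlap≡2 (addressing (g u) (g v))) ⟩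
        form z (λ _ _ → + 2)            ≡⟨ form-const≡0 z ∑z≡0 (+ 2) ⟩
        0ℤ                              ∎

    kernel-witness : suc (suc t) ℕ.< k → (sel : Fin k) →
                     ∃[ z ] ¬ IsZero z × z sel ≡ 0ℤ × IsZero (lincomb z (incidence ∘ g)) × IsZero (lincomb z (letters χ))
    kernel-witness 2+t<k sel = z , z≢0 , z-sel≡0 , incidence-combination≡0 z ∑z≡0 χ-comb≡0 , χ-comb≡0
      where
      constraints : Fin (suc (suc t)) → Vector ℤ k
      constraints zero          = δ sel
      constraints (suc zero)    = λ _ → 1ℤ
      constraints (suc (suc c)) = λ u → letters χ u c
      solution = homogeneous-solution 2+t<k constraints
      z = proj₁ solution
      z≢0 = proj₁ (proj₂ solution)
      z⊥ = proj₂ (proj₂ solution)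
      z-sel≡0 : z sel ≡ 0ℤ
      z-sel≡0 = trans (sym (·-δ z sel)) (z⊥ zero)
      ∑z≡0 : sum z ≡ 0ℤ
      ∑z≡0 = trans (sum-cong-≗ λ u → sym (ℤ.*-identityʳ (z u))) (z⊥ (suc zero))
      χ-comb≡0 : IsZero (lincomb z (letters χ))
      χ-comb≡0 c = z⊥ (suc (suc c))

-- The triangle 123 together with the star at 0

star-triangle-kernel : ∀ {a b c d e f : ℤ} → d + e + f ≡ 0ℤ → a + b + d ≡ 0ℤ → a + c + e ≡ 0ℤ → b + c + f ≡ 0ℤ →
                       c ≡ - a - b × d ≡ - a - b × e ≡ b × f ≡ a
star-triangle-kernel {a} {b} {c} {d} {e} {f} E₀ E₁ E₂ E₃ =
  up-to a+b+c≡0 (solve (a ∷ b ∷ c ∷ [])) ,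
  up-to E₁ (solve (a ∷ b ∷ d ∷ [])) ,
  up-to (cong₂ _-_ E₂ a+b+c≡0) (solve (a ∷ b ∷ c ∷ e ∷ [])) ,
  up-to (cong₂ _-_ E₃ a+b+c≡0) (solve (a ∷ b ∷ c ∷ f ∷ []))
  where
  up-to : ∀ {x y ε} → ε ≡ 0ℤ → x ≡ y + ε → x ≡ y
  up-to {y = y} refl x≡y+ε = trans x≡y+ε (ℤ.+-identityʳ y)
  a+b+c≡0 : a + b + c ≡ 0ℤ
  a+b+c≡0 = *-cancel-≡0 {+ 2} (λ ()) (begin
    + 2 * (a + b + c)                                      ≡⟨ solve (a ∷ b ∷ c ∷ d ∷ e ∷ f ∷ []) ⟩
    (a + b + d) + (a + c + e) + (b + c + f) - (d + e + f)  ≡⟨ cong₂ _-_ (cong₂ _+_ (cong₂ _+_ E₁ E₂) E₃) E₀ ⟩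
    0ℤ                                                     ∎)

module Configuration (r : ℕ) where

  star : Fin (3 ℕ.+ r) → TVertex (4 ℕ.+ r)
  star j = (zero , suc j) , s≤s ℕ.z≤n

  e₀₁ e₀₂ e₀₃ e₁₂ e₁₃ e₂₃ : TVertex (4 ℕ.+ r)
  e₀₁ = star 0F
  e₀₂ = star 1F
  e₀₃ = star 2F
  e₁₂ = (1F , 2F) , s≤s (s≤s ℕ.z≤n)
  e₁₃ = (1F , 3F) , s≤s (s≤s ℕ.z≤n)
  e₂₃ = (2F , 3F) , s≤s (s≤s (s≤s ℕ.z≤n))

  configuration : Fin (6 ℕ.+ r) → TVertex (4 ℕ.+ r)
  configuration 0F = e₁₂
  configuration 1F = e₁₃
  configuration 2F = e₂₃
  configuration (suc (suc (suc j))) = star j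

  -- a times the alternating sum of e₁₂, e₂₃, e₀₃, e₀₁ (around the 4-cycle 1230) plus
  -- b times that of e₁₃, e₂₃, e₀₂, e₀₁ (around 1320); these span the incidence kernel.
  kernelVector : ℤ → ℤ → Vector ℤ (6 ℕ.+ r)
  kernelVector a b 0F = a
  kernelVector a b 1F = b
  kernelVector a b 2F = - a - b
  kernelVector a b 3F = - a - b
  kernelVector a b 4F = b
  kernelVector a b 5F = a
  kernelVector a b (suc (suc (suc (suc (suc (suc _)))))) = 0ℤ

  InKernel : Vector ℤ (6 ℕ.+ r) → Set
  InKernel z = IsZero (lincomb z (incidence ∘ configuration))

  kernel-decomposition : ∀ z → InKernel z → ∀ u → z u ≡ kernelVector (z 0F) (z 1F) u
  kernel-decomposition z s≡0 = decomposition
    where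
    s = lincomb z (incidence ∘ configuration)

    tail≡0 : ∀ j → z (6 ↑ʳ j) ≡ 0ℤ
    tail≡0 j = begin
      z (6 ↑ʳ j)                                ≡⟨ ·-δ (z ∘ (6 ↑ʳ_)) j ⟨
      ∑[ j′ < r ] (z (6 ↑ʳ j′) * δ j j′)
        ≡⟨ sum-cong-≗ (λ j′ → cong (z (6 ↑ʳ j′) *_) (trans (δ-sym j j′) (sym (ℤ.+-identityˡ (δ j′ j))))) ⟩
      ∑[ j′ < r ] (z (6 ↑ʳ j′) * (0ℤ + δ j′ j)) ≡⟨ six-zeros (z 0F) (z 1F) (z 2F) (z 3F) (z 4F) (z 5F) _ ⟨
      s (4 ↑ʳ j)                                ≡⟨ s≡0 (4 ↑ʳ j) ⟩
      0ℤ                                        ∎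
      where
      six-zeros : ∀ a b c d e f x → a * 0ℤ + (b * 0ℤ + (c * 0ℤ + (d * 0ℤ + (e * 0ℤ + (f * 0ℤ + x))))) ≡ x
      six-zeros = solve-∀

    tail-sum : Fin (4 ℕ.+ r) → ℤ
    tail-sum i = ∑[ j < r ] (z (6 ↑ʳ j) * incidence (star (3 ↑ʳ j)) i)

    vertex-equation : ∀ {x} i → x + tail-sum i ≡ s i → x ≡ 0ℤ
    vertex-equation {x} i x+tail≡s = begin
      x              ≡⟨ ℤ.+-identityʳ x ⟨
      x + 0ℤ         ≡⟨ cong (_+_ x) (∑-zero _ λ j → trans (cong (_* incidence (star (3 ↑ʳ j)) i) (tail≡0 j))
                                                     (ℤ.*-zeroˡ (incidence (star (3 ↑ʳ j)) i))) ⟨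
      x + tail-sum i ≡⟨ x+tail≡s ⟩
      s i            ≡⟨ s≡0 i ⟩
      0ℤ             ∎

    solution = star-triangle-kernel
      (vertex-equation 0F (at-0 (z 0F) (z 1F) (z 2F) (z 3F) (z 4F) (z 5F) (tail-sum 0F)))
      (vertex-equation 1F (at-1 (z 0F) (z 1F) (z 2F) (z 3F) (z 4F) (z 5F) (tail-sum 1F)))
      (vertex-equation 2F (at-2 (z 0F) (z 1F) (z 2F) (z 3F) (z 4F) (z 5F) (tail-sum 2F)))
      (vertex-equation 3F (at-3 (z 0F) (z 1F) (z 2F) (z 3F) (z 4F) (z 5F) (tail-sum 3F)))
      where
      at-0 : ∀ a b c d e f x → d + e + f + x ≡ a * 0ℤ + (b * 0ℤ + (c * 0ℤ + (d * 1ℤ + (e * 1ℤ + (f * 1ℤ + x)))))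
      at-0 = solve-∀
      at-1 : ∀ a b c d e f x → a + b + d + x ≡ a * 1ℤ + (b * 1ℤ + (c * 0ℤ + (d * 1ℤ + (e * 0ℤ + (f * 0ℤ + x)))))
      at-1 = solve-∀
      at-2 : ∀ a b c d e f x → a + c + e + x ≡ a * 1ℤ + (b * 0ℤ + (c * 1ℤ + (d * 0ℤ + (e * 1ℤ + (f * 0ℤ + x)))))
      at-2 = solve-∀
      at-3 : ∀ a b c d e f x → b + c + f + x ≡ a * 0ℤ + (b * 1ℤ + (c * 1ℤ + (d * 0ℤ + (e * 0ℤ + (f * 1ℤ + x)))))
      at-3 = solve-∀

    decomposition : ∀ u → z u ≡ kernelVector (z 0F) (z 1F) u
    decomposition 0F = refl
    decomposition 1F = refl
    decomposition 2F = proj₁ solution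
    decomposition 3F = proj₁ (proj₂ solution)
    decomposition 4F = proj₁ (proj₂ (proj₂ solution))
    decomposition 5F = proj₂ (proj₂ (proj₂ solution))
    decomposition (suc (suc (suc (suc (suc (suc j)))))) = tail≡0 j

  kernelVector-zero : ∀ u → kernelVector 0ℤ 0ℤ u ≡ 0ℤ
  kernelVector-zero 0F = refl
  kernelVector-zero 1F = refl
  kernelVector-zero 2F = refl
  kernelVector-zero 3F = refl
  kernelVector-zero 4F = refl
  kernelVector-zero 5F = refl
  kernelVector-zero (suc (suc (suc (suc (suc (suc _)))))) = refl

  lincomb-kernelVector : ∀ {t} a b (L : Fin (6 ℕ.+ r) → Vector ℤ t) c →
    lincomb (kernelVector a b) L c ≡ a * (L 0F c - L 2F c + L 5F c - L 3F c) + b * (L 1F c - L 2F c + L 4F c - L 3F c)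
  lincomb-kernelVector a b L c =
    trans (cong (λ x → a * L 0F c + (b * L 1F c + ((- a - b) * L 2F c + ((- a - b) * L 3F c + (b * L 4F c + (a * L 5F c + x))))))
                (∑-zero {r} _ λ _ → refl))
          (regroup a b (L 0F c) (L 1F c) (L 2F c) (L 3F c) (L 4F c) (L 5F c))
    where
    regroup : ∀ a b l₀ l₁ l₂ l₃ l₄ l₅ →
      a * l₀ + (b * l₁ + ((- a - b) * l₂ + ((- a - b) * l₃ + (b * l₄ + (a * l₅ + 0ℤ))))) ≡
      a * (l₀ - l₂ + l₅ - l₃) + b * (l₁ - l₂ + l₄ - l₃)
    regroup = solve-∀

-- Parity in the triangle 01, 02, 12

alternating : (Sym → ℤ) → Sym → Sym → Sym → Sym → ℤ
alternating χ w x y z = χ w - χ x + χ y - χ z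

Balanced : (Sym → ℤ) → (x₀₁ x₀₂ x₀₃ x₁₂ x₁₃ x₂₃ : Sym) → Set
Balanced χ x₀₁ x₀₂ x₀₃ x₁₂ x₁₃ x₂₃ =
  alternating χ x₁₂ x₂₃ x₀₃ x₀₁ ≡ 0ℤ × alternating χ x₁₃ x₂₃ x₀₂ x₀₁ ≡ 0ℤ

balanced? : ∀ χ x₀₁ x₀₂ x₀₃ x₁₂ x₁₃ x₂₃ → Dec (Balanced χ x₀₁ x₀₂ x₀₃ x₁₂ x₁₃ x₂₃)
balanced? χ x₀₁ x₀₂ x₀₃ x₁₂ x₁₃ x₂₃ =
  alternating χ x₁₂ x₂₃ x₀₃ x₀₁ ℤ.≟ 0ℤ ×-dec alternating χ x₁₃ x₂₃ x₀₂ x₀₁ ℤ.≟ 0ℤ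

∀-Sym? : {P : Sym → Set} → (∀ x → Dec (P x)) → Dec (∀ x → P x)
∀-Sym? P? = map′ (λ { (p₀ , pa , pb) → λ { s0 → p₀ ; sa → pa ; sb → pb } })
                 (λ p → p s0 , p sa , p sb)
                 (P? s0 ×-dec P? sa ×-dec P? sb)

triangle : Sym → Sym → Sym → ℤ
triangle x y z = + mismatch x y + + mismatch x z + + mismatch y z

-- The reason: balance leaves each perfect matching of K₄
-- free of a, free of b, or carrying exactly one a and one b; in the last case the triangle
-- 01, 02, 12 holds k letters a and 3 − k letters b, hence k (3 − k) mismatches.
triangle-even : ∀ x₀₁ x₀₂ x₀₃ x₁₂ x₁₃ x₂₃ →
  Balanced isA x₀₁ x₀₂ x₀₃ x₁₂ x₁₃ x₂₃ → Balanced isB x₀₁ x₀₂ x₀₃ x₁₂ x₁₃ x₂₃ →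
  + 2 ∣ triangle x₀₁ x₀₂ x₁₂
triangle-even = from-yes
  (∀-Sym? λ x₀₁ → ∀-Sym? λ x₀₂ → ∀-Sym? λ x₀₃ → ∀-Sym? λ x₁₂ → ∀-Sym? λ x₁₃ → ∀-Sym? λ x₂₃ →
   balanced? isA x₀₁ x₀₂ x₀₃ x₁₂ x₁₃ x₂₃ →-dec balanced? isB x₀₁ x₀₂ x₀₃ x₁₂ x₁₃ x₂₃ →-dec
   + 2 ∣? triangle x₀₁ x₀₂ x₁₂)

∣-sum : ∀ {k} {d} {x : Vector ℤ k} → (∀ i → d ∣ x i) → d ∣ sum x
∣-sum {zero}  _   = divides 0ℤ refl
∣-sum {suc k} d∣x = ∣m∣n⇒∣m+n (d∣x zero) (∣-sum (d∣x ∘ suc))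

module _ {r t} {f : TVertex (4 ℕ.+ r) → Vec Sym t} (addressing : IsAddressing TAdj t f) (t<n : t ℕ.< 4 ℕ.+ r) where
  open Configuration r

  symbol : TVertex (4 ℕ.+ r) → Fin t → Sym
  symbol u c = lookup (f u) c

  cycles-balanced : ∀ {χ χ′ : Sym → ℤ} → (∀ x y → + mismatch x y ≡ χ x * χ′ y + χ′ x * χ y) →
                    ∀ c → Balanced χ (symbol e₀₁ c) (symbol e₀₂ c) (symbol e₀₃ c)
                                     (symbol e₁₂ c) (symbol e₁₃ c) (symbol e₂₃ c)
  cycles-balanced {χ} {χ′} split c = cycle₁₂₃₀≡0 , cycle₁₃₂₀≡0
    where
    L = letters {f = f} addressing configuration χ
    cycle₁₂₃₀ = L 0F c - L 2F c + L 5F c - L 3F c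
    cycle₁₃₂₀ = L 1F c - L 2F c + L 4F c - L 3F c

    relation : ∀ z → InKernel z → IsZero (lincomb z L) → z 0F * cycle₁₂₃₀ + z 1F * cycle₁₃₂₀ ≡ 0ℤ
    relation z kernel L-comb≡0 = begin
      z 0F * cycle₁₂₃₀ + z 1F * cycle₁₃₂₀
        ≡⟨ lincomb-kernelVector (z 0F) (z 1F) L c ⟨
      lincomb (kernelVector (z 0F) (z 1F)) L c
        ≡⟨ sum-cong-≗ (λ u → cong (_* L u c) (kernel-decomposition z kernel u)) ⟨
      lincomb z L c
        ≡⟨ L-comb≡0 c ⟩
      0ℤ
        ∎

    not-both-zero : ∀ z → InKernel z → ¬ IsZero z → z 0F ≡ 0ℤ → z 1F ≢ 0ℤ
    not-both-zero z kernel z≢0 a≡0 b≡0 = z≢0 λ u →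
      trans (kernel-decomposition z kernel u) (trans (cong₂ (λ a b → kernelVector a b u) a≡0 b≡0) (kernelVector-zero u))

    Witness : Fin (6 ℕ.+ r) → Set
    Witness sel = ∃[ z ] ¬ IsZero z × z sel ≡ 0ℤ × InKernel z × IsZero (lincomb z L)

    -- Prescribing z sel = 0 cuts the two-dimensional kernel down to one cycle.
    witness : ∀ sel → Witness sel
    witness = kernel-witness {f = f} addressing configuration {χ} {χ′} split (s≤s (s≤s t<n))

    cycle₁₂₃₀≡0 : cycle₁₂₃₀ ≡ 0ℤ
    cycle₁₂₃₀≡0 = from-witness (witness 1F)
      where
      from-witness : Witness 1F → cycle₁₂₃₀ ≡ 0ℤ
      from-witness (z , z≢0 , b≡0 , kernel , L-comb≡0) =
        *-cancel-≡0 (λ a≡0 → not-both-zero z kernel z≢0 a≡0 b≡0)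
          (trans (sym (ℤ.+-identityʳ _))
                 (trans (cong (λ b → z 0F * cycle₁₂₃₀ + b * cycle₁₃₂₀) (sym b≡0)) (relation z kernel L-comb≡0)))

    cycle₁₃₂₀≡0 : cycle₁₃₂₀ ≡ 0ℤ
    cycle₁₃₂₀≡0 = from-witness (witness 0F)
      where
      from-witness : Witness 0F → cycle₁₃₂₀ ≡ 0ℤ
      from-witness (z , z≢0 , a≡0 , kernel , L-comb≡0) =
        *-cancel-≡0 (not-both-zero z kernel z≢0 a≡0)
          (trans (sym (ℤ.+-identityˡ _))
                 (trans (cong (λ a → a * cycle₁₂₃₀ + z 1F * cycle₁₃₂₀) (sym a≡0)) (relation z kernel L-comb≡0)))

  ∑-mismatch-adjacent : ∀ {u v} → TAdj u v → ∑[ c < t ] (+ mismatch (symbol u c) (symbol v c)) ≡ 1ℤ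
  ∑-mismatch-adjacent {u} {v} adj = trans (sym (+addrDist≡∑ (f u) (f v))) (cong +_ (adjacent⇒dist≡1 adj (addressing u v)))

  triangle-even-at : ∀ c → + 2 ∣ triangle (symbol e₀₁ c) (symbol e₀₂ c) (symbol e₁₂ c)
  triangle-even-at c = triangle-even (symbol e₀₁ c) (symbol e₀₂ c) (symbol e₀₃ c)
                                     (symbol e₁₂ c) (symbol e₁₃ c) (symbol e₂₃ c)
                                     (cycles-balanced {isA} {isB} mismatch-split c) (cycles-balanced {isB} {isA} mismatch-split′ c)

  no-short-addressing : ⊥
  no-short-addressing = 2∤3 (subst (+ 2 ∣_) total (∣-sum triangle-even-at))
    where
    2∤3 : ¬ (+ 2 ∣ + 3)
    2∤3 = from-no (+ 2 ∣? + 3)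
    total : ∑[ c < t ] triangle (symbol e₀₁ c) (symbol e₀₂ c) (symbol e₁₂ c) ≡ + 3
    total = begin
      ∑[ c < t ] triangle (symbol e₀₁ c) (symbol e₀₂ c) (symbol e₁₂ c)
        ≡⟨ ∑-distrib-+ (λ c → mismatch-at e₀₁ e₀₂ c + mismatch-at e₀₁ e₁₂ c) (mismatch-at e₀₂ e₁₂) ⟩
      ∑[ c < t ] (mismatch-at e₀₁ e₀₂ c + mismatch-at e₀₁ e₁₂ c) + sum (mismatch-at e₀₂ e₁₂)
        ≡⟨ cong (_+ sum (mismatch-at e₀₂ e₁₂)) (∑-distrib-+ (mismatch-at e₀₁ e₀₂) (mismatch-at e₀₁ e₁₂)) ⟩
      sum (mismatch-at e₀₁ e₀₂) + sum (mismatch-at e₀₁ e₁₂) + sum (mismatch-at e₀₂ e₁₂)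
        ≡⟨ cong₂ _+_ (cong₂ _+_ (∑-mismatch-adjacent ((λ { (_ , ()) }) , inj₁ refl))
                                (∑-mismatch-adjacent ((λ { (() , _) }) , inj₂ (inj₂ (inj₁ refl)))))
                     (∑-mismatch-adjacent ((λ { (() , _) }) , inj₂ (inj₂ (inj₂ refl)))) ⟩
      + 3
        ∎
      where
      mismatch-at : TVertex (4 ℕ.+ r) → TVertex (4 ℕ.+ r) → Fin t → ℤ
      mismatch-at u v c = + mismatch (symbol u c) (symbol v c)

mainTheorem3 : ∀ (n : ℕ) → 4 ≤ n → ∀ (t : ℕ) (f : TVertex n → Vec Sym t) →
                 IsAddressing (TAdj {n}) t f → n ≤ t
mainTheorem3 _ (s≤s (s≤s (s≤s (s≤s {n = r} ℕ.z≤n)))) t f addressing =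
  ℕ.≮⇒≥ (no-short-addressing {f = f} addressing)
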